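{- Let $\pi=\pi_1\pi_2\cdots\pi_n$ be a $132$-avoiding permutation of $\{1,\dots,n\}$ and let $P=\Phi(\pi)$ be the corresponding Dyck path. Then: (1) For each $j$, the $j$-th down-step of $P$ (counted from the left) goes from height $i$ to height $i-1$ if and only if the maximal length of an increasing subsequence of $\pi$ whose first element is $\pi_j$ equals $i$; thus down-steps of $P$ from height $i$ to height $i-1$ correspond one-to-one to elements $\pi_j$ that are the first element of an occurrence of the pattern $12\dots i$ which is maximal subject to having $\pi_j$ as first element. (2) If $P$ contains a contiguous portion which starts at a point of height $h+i-1$ and ends at a point of height $h$ (for some $h\ge0$, $i\ge1$), and this portion is immediately followed in $P$ by an up-step, then $\pi$ contains an occurrence of the pattern $23\dots i1$.
   Context: For a permutation $\pi$ and a pattern $\sigma=\sigma_1\cdots\sigma_m$ (a permutation of $\{1,\dots,m\}$), an occurrence of $\sigma$ in $\pi$ is a choice of indices $i_1<\dots<i_m$ with $\pi_{i_1}\cdots\pi_{i_m}$ in the same relative order as $\sigma$; $\pi$ is $\sigma$-avoiding if it has no occurrence. A Dyck path is a lattice path with up-steps $(1,1)$ and down-steps $(1,-1)$ never going below the $x$-axis. The map $\Phi$ sends a $132$-avoiding permutation $\pi=\pi_1\cdots\pi_n$ to the Dyck path from $(0,0)$ to $(2n,0)$ constructed as follows: read $\pi$ from left to right; when $\pi_j$ is read, append as many up-steps as necessary (possibly zero) followed by one down-step from height $h_j+1$ to height $h_j$, where $h_j$ is the number of elements among $\pi_{j+1},\dots,\pi_n$ that are larger than $\pi_j$. (This is well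 defined for $132$-avoiding $\pi$ and is a bijection onto Dyck paths from $(0,0)$ to $(2n,0)$.) The pattern $23\dots i1$ is the permutation of $\{1,\dots,i\}$ with $\sigma_j=j+1$ for $j<i$ and $\sigma_i=1$. -}

module Defs where

open import Data.Nat using (ℕ; zero; suc; _+_; _∸_)
open import Data.Nat.Properties using (_<?_)
open import Data.Fin using (Fin; zero; suc; toℕ; fromℕ<; _<_)
open import Data.Fin.Properties as FinP using ()
open import Data.List using (List; []; _∷_; _++_; replicate; length; filter; allFin; map)
open import Data.Maybe using (Maybe; just; nothing)
open import Data.Product using (Σ; _×_; _,_)
open import Data.Empty using (⊥)
open import Data.Vec using (Vec; lookup; []; _∷_)
open import Relation.Nullary using (¬_; yes; no)
open import Relation.Nullary.Decidable using (_×-dec_)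
open import Relation.Binary.PropositionalEquality using (_≡_)
open import Function.Definitions using (Injective)

-- Permutations of {0,…,n-1} (0-based values; only relative order matters).
IsPerm : ∀ {n} → (Fin n → Fin n) → Set
IsPerm π = Injective _≡_ _≡_ π

Occurrence : ∀ {m n} → (Fin m → Fin m) → (Fin n → Fin n) → Set
Occurrence {m} {n} σ π =
  Σ (Fin m → Fin n) λ f →
    (∀ a b → a < b → f a < f b) ×
    (∀ a b → (σ a < σ b → π (f a) < π (f b)) × (π (f a) < π (f b) → σ a < σ b))

Contains : ∀ {m n} → (Fin m → Fin m) → (Fin n → Fin n) → Set
Contains σ π = Occurrence σ π

Avoids : ∀ {m n} → (Fin m → Fin m) → (Fin n → Fin n) → Set
Avoids σ π = ¬ Occurrence σ π

p132 : Fin 3 → Fin 3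
p132 = lookup (zero ∷ suc (suc zero) ∷ suc zero ∷ [])

pInc : ∀ m → Fin m → Fin m
pInc m a = a

-- the pattern 23…i1 with i = suc k (0-based: a ↦ a+1 for a < k, k ↦ 0)
pCyc : ∀ k → Fin (suc k) → Fin (suc k)
pCyc k a with toℕ a <? k
... | yes p = fromℕ< {suc (toℕ a)} (Data.Nat.s≤s p)
... | no _ = zero

IncFrom : ∀ {n} → (Fin n → Fin n) → Fin n → ℕ → Set
IncFrom π j zero = ⊥
IncFrom π j (suc m) =
  Σ (Occurrence (pInc (suc m)) π) λ occ → Data.Product.proj₁ occ zero ≡ j

MaxIncFromIs : ∀ {n} → (Fin n → Fin n) → Fin n → ℕ → Set
MaxIncFromIs π j i = IncFrom π j i × (∀ m → IncFrom π j m → m Data.Nat.≤ i)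

data Step : Set where
  U D : Step

hgt : ∀ {n} → (Fin n → Fin n) → Fin n → ℕ
hgt {n} π j = length (filter (λ k → (toℕ j <? toℕ k) ×-dec (toℕ (π j) <? toℕ (π k))) (allFin n))

-- from current height cur, for each h: up-steps to height h+1, then one down-step
buildPath : ℕ → List ℕ → List Step
buildPath cur [] = []
buildPath cur (h ∷ hs) = replicate (suc h ∸ cur) U ++ (D ∷ buildPath h hs)

Φ : ∀ {n} → (Fin n → Fin n) → List Step
Φ {n} π = buildPath 0 (map (hgt π) (allFin n))

downStarts : ℕ → List Step → List ℕ
downStarts c [] = []
downStarts c (U ∷ s) = downStarts (suc c) s
downStarts c (D ∷ s) = c ∷ downStarts (Data.Nat.pred c) s

-- 0-based list indexing
nth : ∀ {A : Set} → List A → ℕ → Maybe A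
nth [] _ = nothing
nth (x ∷ xs) zero = just x
nth (x ∷ xs) (suc k) = nth xs k

ups : List Step → ℕ
ups [] = 0
ups (U ∷ s) = suc (ups s)
ups (D ∷ s) = ups s

downs : List Step → ℕ
downs [] = 0
downs (U ∷ s) = downs s
downs (D ∷ s) = suc (downs s)

{-# OPTIONS --safe #-}
module Submission where

-- In a 132-avoiding permutation the entries that lie to the right of π j and exceed it appear in
-- increasing order (two of them in decreasing order would complete a 132 with π j), and each of
-- them lying to the right of a position p ≥ j also exceeds π p. Hence the longest increasing
-- subsequence starting at π j has length hgt π j + 1, and hgt drops by at most one from each
-- position to the next, so the j-th down-step of Φ π starts at height hgt π j + 1.
-- For (2) with i ≥ 2, let e be the first down-step after the start of the portion, p the last one
-- before the up-step and m = p + 1 the next one. The heights give hgt p ≤ h ≤ hgt m, forcing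
-- π m < π p and then π m < π e, and hgt e ≥ hgt p + i − 2, so at least i − 2 entries exceeding
-- π e lie at positions ≤ p. Preceded by π e and followed by π m they form a 23⋯i1.

open import Defs
open import Data.Bool using (true; false)
open import Data.Empty using (⊥-elim)
open import Data.Fin as F using (Fin; zero; suc; toℕ; fromℕ<; inject₁; inject≤)
import Data.Fin.Properties as Finₚ
open Finₚ using (toℕ-injective; toℕ<n; toℕ-fromℕ<; toℕ-inject₁; toℕ-inject≤)
open import Data.List using (List; []; _∷_; _++_; replicate; length; filter; allFin; map; tabulate; lookup)
open import Data.List.Properties using (map-tabulate; ∷-injectiveʳ; filter-some; filter-none; ++-assoc)
open import Data.List.Membership.Propositional.Properties using (∈-allFin; ∈-lookup)
open import Data.List.Relation.Binary.Sublist.Propositional using (⊆-refl)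
open import Data.List.Relation.Binary.Sublist.Propositional.Properties using (filter⁺; length-mono-≤)
open import Data.List.Relation.Unary.All as All using (All; []; _∷_)
open import Data.List.Relation.Unary.All.Properties using (all-filter)
open import Data.List.Relation.Unary.AllPairs using (AllPairs; []; _∷_)
import Data.List.Relation.Unary.AllPairs.Properties as AllPairs
import Data.List.Relation.Unary.Any as Any
open import Data.List.Relation.Unary.Linked using (Linked; [-]; _∷_)
open import Data.List.Relation.Unary.Unique.Propositional using (Unique)
open import Data.List.Relation.Unary.Unique.Propositional.Properties using (allFin⁺)
open import Data.Maybe using (just)
open import Data.Maybe.Properties using (just-injective)
open import Data.Nat using (ℕ; zero; suc; _+_; _∸_; _≤_; _<_; z≤n; s≤s; _≤?_; _<?_)
open import Data.Nat.Properties
open import Data.Product using (Σ; ∃-syntax; _×_; _,_; proj₁; proj₂)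
open import Data.Sum using (_⊎_; inj₁; inj₂)
open import Function using (_∘_; id)
open import Level using (0ℓ)
open import Relation.Binary.Core using (Rel; _Preserves_⟶_)
open import Relation.Binary.Definitions using (tri<; tri≈; tri>)
open import Relation.Binary.PropositionalEquality
open import Relation.Nullary using (¬_; Dec; yes; no; does; ¬?)
open import Relation.Nullary.Decidable using (_×-dec_)
open import Relation.Unary using (Pred; Decidable; _⊆_)

count : ∀ {A : Set} {P : Pred A 0ℓ} → Decidable P → List A → ℕ
count P? xs = length (filter P? xs)

module _ {A : Set} {P Q : Pred A 0ℓ} (P? : Decidable P) (Q? : Decidable Q) where

  count-mono : P ⊆ Q → ∀ xs → count P? xs ≤ count Q? xs
  count-mono P⊆Q xs = length-mono-≤ (filter⁺ P? Q? (λ { refl → P⊆Q }) (⊆-refl {x = xs}))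

  count-split : ∀ xs →
    count P? xs ≡ count (λ x → P? x ×-dec Q? x) xs + count (λ x → P? x ×-dec ¬? (Q? x)) xs
  count-split [] = refl
  count-split (x ∷ xs) with does (P? x) | does (Q? x)
  ... | false | _     = count-split xs
  ... | true  | true  = cong suc (count-split xs)
  ... | true  | false = trans (cong suc (count-split xs)) (sym (+-suc _ _))

count-subsingleton : ∀ {A : Set} {P : Pred A 0ℓ} (P? : Decidable P) {xs} → Unique xs →
  (∀ {x y} → P x → P y → x ≡ y) → count P? xs ≤ 1
count-subsingleton P? []                   _        = z≤n
count-subsingleton P? {x ∷ xs} (x∉xs ∷ xs!) P-unique with P? x
... | no _   = count-subsingleton P? xs! P-unique
... | yes px = s≤s (≤-reflexive (cong length
                 (filter-none P? (All.map (λ x≢y py → x≢y (P-unique px py)) x∉xs))))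

module _ {A : Set} {R : Rel A 0ℓ} where

  AllPairs-lookup : ∀ {xs} → AllPairs R xs → ∀ {i j} → i F.< j → R (lookup xs i) (lookup xs j)
  AllPairs-lookup (Rx ∷ _)  {zero}  {suc j} _         = All.lookup Rx (∈-lookup j)
  AllPairs-lookup (_ ∷ Rxs) {suc i} {suc j} (s≤s i<j) = AllPairs-lookup Rxs i<j

  AllPairs-restrict : ∀ {P : Pred A 0ℓ} {xs} → All P xs →
    AllPairs (λ x y → P x → P y → R x y) xs → AllPairs R xs
  AllPairs-restrict []         []         = []
  AllPairs-restrict (px ∷ pxs) (Rx ∷ Rxs) =
    All.zipWith (λ (R′ , py) → R′ px py) (Rx , pxs) ∷ AllPairs-restrict pxs Rxs

module _ {A : Set} where

  nth-tabulate : ∀ {n} (f : Fin n → A) j → nth (tabulate f) (toℕ j) ≡ just (f j)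
  nth-tabulate f zero    = refl
  nth-tabulate f (suc j) = nth-tabulate (f ∘ suc) j

  nth-tabulate⁻ : ∀ {n} (f : Fin n → A) {i x} → nth (tabulate f) i ≡ just x →
    ∃[ j ] toℕ j ≡ i × f j ≡ x
  nth-tabulate⁻ {suc n} f {zero}  refl = zero , refl , refl
  nth-tabulate⁻ {suc n} f {suc i} e with nth-tabulate⁻ (f ∘ suc) e
  ... | j , j≡i , fj≡x = suc j , cong suc j≡i , fj≡x

  Linked-tabulate : ∀ {R : Rel A 0ℓ} {n c} (f : Fin n → A) → (∀ {i} → toℕ i ≡ 0 → R c (f i)) →
    (∀ {i i′} → suc (toℕ i) ≡ toℕ i′ → R (f i) (f i′)) → Linked R (c ∷ tabulate f)
  Linked-tabulate {n = zero}  f first next = [-]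
  Linked-tabulate {n = suc n} f first next =
    first {zero} refl
      ∷ Linked-tabulate (f ∘ suc) (λ i≡0 → next (cong suc (sym i≡0))) (λ e → next (cong suc e))

predecessor : ∀ {n} (j : Fin n) → 0 < toℕ j → Σ (Fin n) λ i → suc (toℕ i) ≡ toℕ j
predecessor (suc i) _ = inject₁ i , cong suc (toℕ-inject₁ i)

_≤1+_ : ℕ → ℕ → Set
a ≤1+ b = a ≤ suc b

downStarts-replicate : ∀ r c s → downStarts c (replicate r U ++ s) ≡ downStarts (r + c) s
downStarts-replicate zero    c s = refl
downStarts-replicate (suc r) c s =
  trans (downStarts-replicate r (suc c) s) (cong (λ h → downStarts h s) (+-suc r c))

downStarts-buildPath : ∀ {c hs} → Linked _≤1+_ (c ∷ hs) → downStarts c (buildPath c hs) ≡ map suc hs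
downStarts-buildPath {c} {[]}     _ = refl
downStarts-buildPath {c} {x ∷ xs} (c≤1+x ∷ linked) = begin
  downStarts c (replicate (suc x ∸ c) U ++ D ∷ buildPath x xs)
    ≡⟨ downStarts-replicate (suc x ∸ c) c _ ⟩
  downStarts (suc x ∸ c + c) (D ∷ buildPath x xs)
    ≡⟨ cong (λ h → downStarts h (D ∷ buildPath x xs)) (m∸n+n≡m c≤1+x) ⟩
  suc x ∷ downStarts x (buildPath x xs)
    ≡⟨ cong (suc x ∷_) (downStarts-buildPath linked) ⟩
  suc x ∷ map suc xs
    ∎
  where open ≡-Reasoning

-- The d-th down-step of buildPath cur hs goes from height suc v to v, where nth hs d ≡ just v.
-- A cut of the path at height t after d down-steps lies on the ascent from the end of the previous
-- down-step (or from the start cur) to the start of the next one.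
record Cut (cur : ℕ) (hs : List ℕ) (d t : ℕ) (Y : List Step) : Set where
  field
    prev≤ : ∀ {v} → nth (cur ∷ hs) d ≡ just v → v ≤ t
    ≤next : ∀ {v} → nth hs d ≡ just v → t ≤ suc v
    <next : ∀ {Y′} → Y ≡ U ∷ Y′ → ∃[ v ] nth hs d ≡ just v × t ≤ v
open Cut

Cut-lower : ∀ {cur hs d t Y} → Cut (suc cur) hs d t Y → Cut cur hs d t Y
Cut-lower {d = d} c = record { prev≤ = prev≤-lower d (prev≤ c) ; ≤next = ≤next c ; <next = <next c }
  where
    prev≤-lower : ∀ {cur hs t} d → (∀ {v} → nth (suc cur ∷ hs) d ≡ just v → v ≤ t) →
      ∀ {v} → nth (cur ∷ hs) d ≡ just v → v ≤ t
    prev≤-lower zero    prev refl = ≤-trans (n≤1+n _) (prev refl)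
    prev≤-lower (suc d) prev      = prev

Cut-start : ∀ {cur r x xs} → cur + r ≡ suc x →
  Cut cur (x ∷ xs) 0 cur (replicate r U ++ D ∷ buildPath x xs)
Cut-start {cur} {r} {x} {xs} cur+r≡1+x = record
  { prev≤ = λ { refl → ≤-refl }
  ; ≤next = λ { refl → ≤-trans (m≤m+n cur r) (≤-reflexive cur+r≡1+x) }
  ; <next = λ U-first → x , refl , cur≤x r cur+r≡1+x U-first
  }
  where
    cur≤x : ∀ {Y′} r → cur + r ≡ suc x → replicate r U ++ D ∷ buildPath x xs ≡ U ∷ Y′ → cur ≤ x
    cur≤x (suc r) cur+r≡1+x _ =
      ≤-trans (m≤m+n cur r) (≤-reflexive (suc-injective (trans (sym (+-suc cur r)) cur+r≡1+x)))

mutual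
  cut-buildPath : ∀ {cur hs X Y t} → Linked _≤1+_ (cur ∷ hs) → buildPath cur hs ≡ X ++ Y →
    ups X + cur ≡ downs X + t → Cut cur hs (downs X) t Y
  cut-buildPath {hs = []} {[]} {[]} _ _ refl = record
    { prev≤ = λ { refl → ≤-refl } ; ≤next = λ () ; <next = λ () }
  cut-buildPath {cur} {x ∷ xs} (cur≤1+x ∷ linked) = cut-block (m+[n∸m]≡n cur≤1+x) linked

  cut-block : ∀ {cur r x xs X Y t} → cur + r ≡ suc x → Linked _≤1+_ (x ∷ xs) →
    replicate r U ++ D ∷ buildPath x xs ≡ X ++ Y → ups X + cur ≡ downs X + t →
    Cut cur (x ∷ xs) (downs X) t Y
  cut-block {X = []} cur+r≡1+x _ refl refl = Cut-start cur+r≡1+x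
  cut-block {cur} {suc r} {X = U ∷ X} cur+r≡1+x linked e ht =
    Cut-lower (cut-block (trans (sym (+-suc cur r)) cur+r≡1+x) linked (∷-injectiveʳ e)
                         (trans (+-suc (ups X) cur) ht))
  cut-block {cur} {zero} {x} {xs} {D ∷ X} {Y} {t} cur+0≡1+x linked e ht =
    -- the fields of Cut cur (x ∷ xs) (suc d) unfold to those of Cut x xs d
    record { prev≤ = prev≤ rest ; ≤next = ≤next rest ; <next = <next rest }
    where
      open ≡-Reasoning
      rest : Cut x xs (downs X) t Y
      rest = cut-buildPath linked (∷-injectiveʳ e) (suc-injective (begin
        suc (ups X + x)   ≡⟨ +-suc (ups X) x ⟨
        ups X + suc x     ≡⟨ cong (ups X +_) (trans (sym (+-identityʳ cur)) cur+0≡1+x) ⟨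
        ups X + cur       ≡⟨ ht ⟩
        suc (downs X + t) ∎))

ups-prefix : ∀ X Y → ups X ≤ ups (X ++ Y)
ups-prefix []      Y = z≤n
ups-prefix (U ∷ X) Y = s≤s (ups-prefix X Y)
ups-prefix (D ∷ X) Y = ups-prefix X Y

downs-gap : ∀ {h k} A B → ups A ≡ downs A + (h + k) → ups (A ++ B) ≡ downs (A ++ B) + h →
  downs A + k ≤ downs (A ++ B)
downs-gap {h} {k} A B eA eAB = +-cancelʳ-≤ h _ _ (begin
  downs A + k + h    ≡⟨ +-assoc (downs A) k h ⟩
  downs A + (k + h)  ≡⟨ cong (downs A +_) (+-comm k h) ⟩
  downs A + (h + k)  ≡⟨ eA ⟨
  ups A              ≤⟨ ups-prefix A B ⟩
  ups (A ++ B)       ≡⟨ eAB ⟩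
  downs (A ++ B) + h ∎)
  where open ≤-Reasoning

maxIncFrom-unique : ∀ {n} {π : Fin n → Fin n} {j a b} →
  MaxIncFromIs π j a → MaxIncFromIs π j b → a ≡ b
maxIncFrom-unique (inc-a , max-a) (inc-b , max-b) = ≤-antisym (max-b _ inc-a) (max-a _ inc-b)

occurrence-via-rank : ∀ {m n} {σ : Fin m → Fin m} {π : Fin n → Fin n}
  (f : Fin m → Fin n) (r : Fin m → ℕ) → f Preserves F._<_ ⟶ F._<_ → r Preserves F._<_ ⟶ _<_ →
  (∀ a → toℕ (π (f a)) ≡ r (σ a)) → Occurrence σ π
occurrence-via-rank {σ = σ} {π} f r f↑ r↑ πf≡rσ =
  f , (λ _ _ → f↑) , λ a b → forward a b , backward a b
  where
    forward : ∀ a b → σ a F.< σ b → toℕ (π (f a)) < toℕ (π (f b))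
    forward a b σa<σb = subst₂ _<_ (sym (πf≡rσ a)) (sym (πf≡rσ b)) (r↑ σa<σb)
    backward : ∀ a b → toℕ (π (f a)) < toℕ (π (f b)) → σ a F.< σ b
    backward a b πfa<πfb with Finₚ.<-cmp (σ a) (σ b)
    ... | tri< σa<σb _ _ = σa<σb
    ... | tri≈ _ σa≡σb _ =
      ⊥-elim (<-irrefl (trans (πf≡rσ a) (trans (cong r σa≡σb) (sym (πf≡rσ b)))) πfa<πfb)
    ... | tri> _ _ σb<σa = ⊥-elim (<-asym πfa<πfb (forward b a σb<σa))

module _ {n} (π : Fin n → Fin n) where

  infix 4 _↗_ _↘_ _↗?_

  _↗_ _↘_ : Fin n → Fin n → Set
  x ↗ y = toℕ x < toℕ y × toℕ (π x) < toℕ (π y)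
  x ↘ y = toℕ x < toℕ y × toℕ (π y) < toℕ (π x)

  _↗?_ : ∀ x y → Dec (x ↗ y)
  x ↗? y = (toℕ x <? toℕ y) ×-dec (toℕ (π x) <? toℕ (π y))

  ↗-trans : ∀ {x y z} → x ↗ y → y ↗ z → x ↗ z
  ↗-trans (x<y , πx<πy) (y<z , πy<πz) = <-trans x<y y<z , <-trans πx<πy πy<πz

  Ascending : ∀ {m} → (Fin m → Fin n) → Set
  Ascending f = f Preserves F._<_ ⟶ _↗_

  hgtUpTo : Fin n → ℕ → ℕ
  hgtUpTo j p = count (λ x → (j ↗? x) ×-dec (toℕ x ≤? p)) (allFin n)

  hgt-split : ∀ j p → hgt π j ≡ hgtUpTo j p + count (λ x → (j ↗? x) ×-dec ¬? (toℕ x ≤? p)) (allFin n)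
  hgt-split j p = count-split (j ↗?_) (λ x → toℕ x ≤? p) (allFin n)

  hgt-↗ : ∀ {x y} → x ↗ y → hgt π y < hgt π x
  hgt-↗ {x} {y} x↗y = begin-strict
    hgt π y
      ≤⟨ count-mono (y ↗?_) after-y (λ y↗z → ↗-trans x↗y y↗z , <⇒≱ (proj₁ y↗z)) (allFin n) ⟩
    count after-y (allFin n)
      <⟨ +-monoˡ-< _ (filter-some _ (Any.map (λ { refl → x↗y , ≤-refl }) (∈-allFin y))) ⟩
    hgtUpTo x (toℕ y) + count after-y (allFin n)
      ≡⟨ hgt-split x (toℕ y) ⟨
    hgt π x
      ∎
    where
      open ≤-Reasoning
      after-y : Decidable (λ z → x ↗ z × ¬ toℕ z ≤ toℕ y)
      after-y z = (x ↗? z) ×-dec ¬? (toℕ z ≤? toℕ y)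

  ascending⇒occurrence : ∀ {m} {f : Fin m → Fin n} → Ascending f → Occurrence (pInc m) π
  ascending⇒occurrence {f = f} f↑ = occurrence-via-rank {π = π} f (λ a → toℕ (π (f a)))
    (λ a<b → proj₁ (f↑ a<b)) (λ a<b → proj₂ (f↑ a<b)) (λ _ → refl)

  ascending-length : ∀ {m} {f : Fin (suc m) → Fin n} → Ascending f → m ≤ hgt π (f zero)
  ascending-length {zero}      _  = z≤n
  ascending-length {suc m} {f} f↑ = ≤-trans
    (s≤s (ascending-length {f = f ∘ suc} (λ a<b → f↑ (s≤s a<b))))
    (hgt-↗ (f↑ {zero} {suc zero} (s≤s z≤n)))

  incFrom-bound : ∀ {j} m → IncFrom π j m → m ≤ suc (hgt π j)
  incFrom-bound (suc m) ((f , f↑ , πf↑) , refl) =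
    s≤s (ascending-length {f = f} (λ {a} {b} a<b → f↑ a b a<b , proj₁ (πf↑ a b) a<b))

  cycle-occurrence : ∀ {k} (g : Fin k → Fin n) (m : Fin n) → Ascending g → (∀ a → g a ↘ m) →
    Occurrence (pCyc k) π
  cycle-occurrence {k} g m g↑ g↘m = occurrence-via-rank {π = π} f rank f↑ rank↑ πf≡rank
    where
      f : Fin (suc k) → Fin n
      f a with toℕ a <? k
      ... | yes a<k = g (fromℕ< a<k)
      ... | no _    = m
      rank : Fin (suc k) → ℕ
      rank zero    = toℕ (π m)
      rank (suc a) = toℕ (π (g a))
      rank↑ : rank Preserves F._<_ ⟶ _<_
      rank↑ {zero}  {suc b} _         = proj₂ (g↘m b)
      rank↑ {suc a} {suc b} (s≤s a<b) = proj₂ (g↑ a<b)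
      πf≡rank : ∀ a → toℕ (π (f a)) ≡ rank (pCyc k a)
      πf≡rank a with toℕ a <? k
      ... | yes _ = refl
      ... | no _  = refl
      f↑ : f Preserves F._<_ ⟶ F._<_
      f↑ {a} {b} a<b with toℕ a <? k | toℕ b <? k
      ... | yes a<k | yes b<k = proj₁ (g↑ (subst₂ _<_ (sym (toℕ-fromℕ< a<k)) (sym (toℕ-fromℕ< b<k)) a<b))
      ... | yes _   | no _    = proj₁ (g↘m _)
      ... | no a≮k  | yes b<k = ⊥-elim (a≮k (<-trans a<b b<k))
      ... | no a≮k  | no _    = ⊥-elim (a≮k (<-≤-trans a<b (≤-pred (toℕ<n b))))

  occurrence-132 : ∀ {a b c} → toℕ a < toℕ b → toℕ b < toℕ c →
    toℕ (π a) < toℕ (π c) → toℕ (π c) < toℕ (π b) → Occurrence p132 π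
  occurrence-132 {a} {b} {c} a<b b<c πa<πc πc<πb =
    occurrence-via-rank {π = π}
      (lookup (a ∷ b ∷ c ∷ [])) (lookup (toℕ (π a) ∷ toℕ (π c) ∷ toℕ (π b) ∷ []))
      (AllPairs-lookup {R = F._<_} ((a<b ∷ <-trans a<b b<c ∷ []) ∷ (b<c ∷ []) ∷ [] ∷ []))
      (AllPairs-lookup {R = _<_} ((πa<πc ∷ <-trans πa<πc πc<πb ∷ []) ∷ (πc<πb ∷ []) ∷ [] ∷ []))
      λ { zero → refl ; (suc zero) → refl ; (suc (suc zero)) → refl }

  module _ (π-injective : IsPerm π) (avoids : Avoids p132 π) where

    ↗⊎↘ : ∀ {x y} → toℕ x < toℕ y → x ↗ y ⊎ x ↘ y
    ↗⊎↘ {x} {y} x<y with <-cmp (toℕ (π x)) (toℕ (π y))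
    ... | tri< πx<πy _ _ = inj₁ (x<y , πx<πy)
    ... | tri≈ _ πx≡πy _ = ⊥-elim (<-irrefl (cong toℕ (π-injective (toℕ-injective πx≡πy))) x<y)
    ... | tri> _ _ πy<πx = inj₂ (x<y , πy<πx)

    ↗-between : ∀ {j p x} → toℕ j ≤ toℕ p → toℕ p < toℕ x → j ↗ x → p ↗ x
    ↗-between {j} {p} {x} j≤p p<x j↗x with m≤n⇒m<n∨m≡n j≤p | ↗⊎↘ p<x
    ... | _        | inj₁ p↗x = p↗x
    ... | inj₁ j<p | inj₂ p↘x = ⊥-elim (avoids (occurrence-132 j<p p<x (proj₂ j↗x) (proj₂ p↘x)))
    ... | inj₂ j≡p | inj₂ p↘x = ⊥-elim (<-asym (proj₂ j↗x)
      (subst (λ q → toℕ (π x) < toℕ (π q)) (sym (toℕ-injective j≡p)) (proj₂ p↘x)))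

    hgt≤hgtUpTo+hgt : ∀ {j p} → toℕ j ≤ toℕ p → hgt π j ≤ hgtUpTo j (toℕ p) + hgt π p
    hgt≤hgtUpTo+hgt {j} {p} j≤p = begin
      hgt π j
        ≡⟨ hgt-split j (toℕ p) ⟩
      hgtUpTo j (toℕ p) + count after-p (allFin n)
        ≤⟨ +-monoʳ-≤ _ (count-mono after-p (p ↗?_)
             (λ (j↗x , x≰p) → ↗-between j≤p (≰⇒> x≰p) j↗x) (allFin n)) ⟩
      hgtUpTo j (toℕ p) + hgt π p
        ∎
      where
        open ≤-Reasoning
        after-p : Decidable (λ x → j ↗ x × ¬ toℕ x ≤ toℕ p)
        after-p x = (j ↗? x) ×-dec ¬? (toℕ x ≤? toℕ p)

    hgtUpTo-gap : ∀ {j p k} → toℕ j ≤ toℕ p → hgt π p + k ≤ hgt π j → k ≤ hgtUpTo j (toℕ p)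
    hgtUpTo-gap {j} {p} {k} j≤p p+k≤j = +-cancelʳ-≤ (hgt π p) k _ (begin
      k + hgt π p                  ≡⟨ +-comm k (hgt π p) ⟩
      hgt π p + k                  ≤⟨ p+k≤j ⟩
      hgt π j                      ≤⟨ hgt≤hgtUpTo+hgt j≤p ⟩
      hgtUpTo j (toℕ p) + hgt π p  ∎)
      where open ≤-Reasoning

    hgt-consecutive : ∀ {j j′} → suc (toℕ j) ≡ toℕ j′ → hgt π j ≤1+ hgt π j′
    hgt-consecutive {j} {j′} j+1≡j′ = begin
      hgt π j
        ≤⟨ hgt≤hgtUpTo+hgt (≤-trans (n≤1+n _) (≤-reflexive j+1≡j′)) ⟩
      hgtUpTo j (toℕ j′) + hgt π j′
        ≤⟨ +-monoˡ-≤ _ (count-subsingleton _ (allFin⁺ n)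
             (λ x≤j′ y≤j′ → toℕ-injective (trans (at-j′ x≤j′) (sym (at-j′ y≤j′))))) ⟩
      suc (hgt π j′)
        ∎
      where
        open ≤-Reasoning
        at-j′ : ∀ {x} → j ↗ x × toℕ x ≤ toℕ j′ → toℕ x ≡ toℕ j′
        at-j′ ((j<x , _) , x≤j′) = ≤-antisym x≤j′ (subst (_≤ toℕ _) j+1≡j′ j<x)

    ascending-run : ∀ {j} {P : Pred (Fin n) 0ℓ} (P? : Decidable P) → (∀ {x} → P x → j ↗ x) →
      ∀ {m} → m ≤ count P? (allFin n) →
      Σ (Fin (suc m) → Fin n) λ f → Ascending f × f zero ≡ j × (∀ a → f a ≡ j ⊎ P (f a))
    ascending-run {j} {P} P? P⇒j↗ {m} m≤count =
      f , f↑ , refl , λ a → All.lookup run-members (∈-lookup (position a))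
      where
        run : List (Fin n)
        run = j ∷ filter P? (allFin n)
        run-members : All (λ x → x ≡ j ⊎ P x) run
        run-members = inj₁ refl ∷ All.map inj₂ (all-filter P? (allFin n))
        run-ascending : AllPairs _↗_ run
        run-ascending = All.map P⇒j↗ (all-filter P? (allFin n))
          ∷ AllPairs-restrict (all-filter P? (allFin n)) (AllPairs.filter⁺ P? (AllPairs.tabulate⁺-<
              λ x<y Px Py → ↗-between (<⇒≤ (proj₁ (P⇒j↗ Px))) x<y (P⇒j↗ Py)))
        position : Fin (suc m) → Fin (length run)
        position a = inject≤ a (s≤s m≤count)
        f : Fin (suc m) → Fin n
        f = lookup run ∘ position
        f↑ : Ascending f
        f↑ {a} {b} a<b =
          AllPairs-lookup run-ascending (subst₂ _<_ (sym (toℕ-inject≤ a _)) (sym (toℕ-inject≤ b _)) a<b)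

    heights-linked : Linked _≤1+_ (0 ∷ tabulate (hgt π))
    heights-linked = Linked-tabulate (hgt π) (λ _ → z≤n) hgt-consecutive

    Φ≡buildPath : Φ π ≡ buildPath 0 (tabulate (hgt π))
    Φ≡buildPath = cong (buildPath 0) (map-tabulate id (hgt π))

    downStart-Φ : ∀ j → nth (downStarts 0 (Φ π)) (toℕ j) ≡ just (suc (hgt π j))
    downStart-Φ j = begin
      nth (downStarts 0 (Φ π)) (toℕ j)
        ≡⟨ cong (λ s → nth (downStarts 0 s) (toℕ j)) Φ≡buildPath ⟩
      nth (downStarts 0 (buildPath 0 (tabulate (hgt π)))) (toℕ j)
        ≡⟨ cong (λ s → nth s (toℕ j)) (downStarts-buildPath heights-linked) ⟩
      nth (map suc (tabulate (hgt π))) (toℕ j)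
        ≡⟨ cong (λ s → nth s (toℕ j)) (map-tabulate (hgt π) suc) ⟩
      nth (tabulate (suc ∘ hgt π)) (toℕ j)
        ≡⟨ nth-tabulate (suc ∘ hgt π) j ⟩
      just (suc (hgt π j))
        ∎
      where open ≡-Reasoning

    maxIncFrom : ∀ j → MaxIncFromIs π j (suc (hgt π j))
    maxIncFrom j =
      let (f , f↑ , f0≡j , _) = ascending-run (j ↗?_) id ≤-refl
      in (ascending⇒occurrence f↑ , f0≡j) , incFrom-bound

    downStep-maxIncFrom : ∀ j i →
      (nth (downStarts 0 (Φ π)) (toℕ j) ≡ just i → MaxIncFromIs π j i) ×
      (MaxIncFromIs π j i → nth (downStarts 0 (Φ π)) (toℕ j) ≡ just i)
    downStep-maxIncFrom j i =
        (λ e → subst (MaxIncFromIs π j) (just-injective (trans (sym (downStart-Φ j)) e)) (maxIncFrom j))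
      , (λ max → trans (downStart-Φ j) (cong just (maxIncFrom-unique (maxIncFrom j) max)))

    cut-Φ : ∀ X {Y t} → Φ π ≡ X ++ Y → ups X ≡ downs X + t → Cut 0 (tabulate (hgt π)) (downs X) t Y
    cut-Φ X e ht = cut-buildPath heights-linked (trans (sym Φ≡buildPath) e) (trans (+-identityʳ _) ht)

    cut-Φ-≤next : ∀ X {Y t j} → Φ π ≡ X ++ Y → ups X ≡ downs X + t → toℕ j ≡ downs X →
      t ≤1+ hgt π j
    cut-Φ-≤next X {j = j} e ht j≡d = ≤next (cut-Φ X e ht)
      (subst (λ d → nth (tabulate (hgt π)) d ≡ just (hgt π j)) j≡d (nth-tabulate (hgt π) j))

    cut-Φ-before-U : ∀ X {C h} → Φ π ≡ X ++ U ∷ C → ups X ≡ downs X + h →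
      Σ (Fin n) λ jm → toℕ jm ≡ downs X × h ≤ hgt π jm ×
                       (∀ {jp} → suc (toℕ jp) ≡ toℕ jm → hgt π jp ≤ h)
    cut-Φ-before-U X {h = h} e ht =
      let (v , next≡v , h≤v)   = <next (cut-Φ X e ht) refl
          (jm , jm≡d , hjm≡v) = nth-tabulate⁻ (hgt π) next≡v
      in jm , jm≡d , subst (h ≤_) (sym hjm≡v) h≤v , λ {jp} jp+1≡jm → prev≤ (cut-Φ X e ht)
           (subst (λ d → nth (0 ∷ tabulate (hgt π)) d ≡ just (hgt π jp)) (trans jp+1≡jm jm≡d)
                  (nth-tabulate (hgt π) jp))

    valley-cycle : ∀ {k} {je jp jm : Fin n} → toℕ je ≤ toℕ jp → suc (toℕ jp) ≡ toℕ jm →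
      hgt π jp + k ≤ hgt π je → hgt π jp ≤ hgt π jm → Occurrence (pCyc (suc k)) π
    valley-cycle {k} {je} {jp} {jm} je≤jp jp+1≡jm jp+k≤je jp≤jm
      with ascending-run (λ x → (je ↗? x) ×-dec (toℕ x ≤? toℕ jp)) proj₁ (hgtUpTo-gap je≤jp jp+k≤je)
    ... | g , g↑ , _ , g-members = cycle-occurrence g jm g↑ g↘jm
      where
        jp<jm : toℕ jp < toℕ jm
        jp<jm = ≤-reflexive jp+1≡jm
        jp↘jm : jp ↘ jm
        jp↘jm with ↗⊎↘ jp<jm
        ... | inj₁ jp↗jm = ⊥-elim (<⇒≱ (hgt-↗ jp↗jm) jp≤jm)
        ... | inj₂ jp↘jm = jp↘jm
        je↘jm : je ↘ jm
        je↘jm with ↗⊎↘ (≤-<-trans je≤jp jp<jm)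
        ... | inj₁ je↗jm = ⊥-elim (<-asym (proj₂ jp↘jm) (proj₂ (↗-between je≤jp jp<jm je↗jm)))
        ... | inj₂ je↘jm = je↘jm
        g↘jm : ∀ a → g a ↘ jm
        g↘jm a with g-members a
        ... | inj₁ ga≡je             = subst (_↘ jm) (sym ga≡je) je↘jm
        ... | inj₂ (je↗ga , ga≤jp) = ≤-<-trans ga≤jp jp<jm , <-trans (proj₂ je↘jm) (proj₂ je↗ga)

    descent-cycle : ∀ h k A B C → Φ π ≡ A ++ B ++ U ∷ C → ups A ≡ downs A + (h + k) →
      ups (A ++ B) ≡ downs (A ++ B) + h → Contains (pCyc k) π
    descent-cycle h k A B C e eA eAB
      with cut-Φ-before-U (A ++ B) (trans e (sym (++-assoc A B (U ∷ C)))) eAB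
    descent-cycle h zero    A B C e eA eAB | jm , _ = cycle-occurrence (λ ()) jm (λ { {()} }) (λ ())
    descent-cycle h (suc k) A B C e eA eAB | jm , jm≡dAB , h≤jm , prev≤h =
      valley-cycle je≤jp jp+1≡jm (≤-trans (+-monoˡ-≤ k jp≤h) h+k≤je) (≤-trans jp≤h h≤jm)
      where
        gap : downs A + suc k ≤ toℕ jm
        gap = subst (downs A + suc k ≤_) (sym jm≡dAB) (downs-gap A B eA eAB)
        dA<jm : downs A < toℕ jm
        dA<jm = <-≤-trans (m<m+n (downs A) (s≤s z≤n)) gap
        jp : Fin n
        jp = proj₁ (predecessor jm (≤-<-trans z≤n dA<jm))
        jp+1≡jm : suc (toℕ jp) ≡ toℕ jm
        jp+1≡jm = proj₂ (predecessor jm (≤-<-trans z≤n dA<jm))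
        jp≤h : hgt π jp ≤ h
        jp≤h = prev≤h jp+1≡jm
        dA<n : downs A < n
        dA<n = <-trans dA<jm (toℕ<n jm)
        je : Fin n
        je = fromℕ< dA<n
        je≤jp : toℕ je ≤ toℕ jp
        je≤jp = subst (_≤ toℕ jp) (sym (toℕ-fromℕ< dA<n))
          (≤-trans (m≤m+n (downs A) k) (≤-pred (subst₂ _≤_ (+-suc (downs A) k) (sym jp+1≡jm) gap)))
        h+k≤je : h + k ≤ hgt π je
        h+k≤je = ≤-pred (subst (_≤ suc (hgt π je)) (+-suc h k)
                                (cut-Φ-≤next A e eA (toℕ-fromℕ< dA<n)))

mainTheorem7 : ∀ n (π : Fin n → Fin n) → IsPerm π → Avoids p132 π →
    (∀ (j : Fin n) (i : ℕ) →
      (nth (downStarts 0 (Φ π)) (toℕ j) ≡ just i → MaxIncFromIs π j i) ×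
      (MaxIncFromIs π j i → nth (downStarts 0 (Φ π)) (toℕ j) ≡ just i))
    ×
    (∀ (h k : ℕ) (A B C : List Step) →
      Φ π ≡ A ++ B ++ (U ∷ C) →
      ups A ≡ downs A + (h + k) →
      ups (A ++ B) ≡ downs (A ++ B) + h →
      Contains (pCyc k) π)
mainTheorem7 n π π-injective avoids =
  downStep-maxIncFrom π π-injective avoids , descent-cycle π π-injective avoids
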